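{- Let $\mathsf{EVEN}$ be the family of sets $S\cup\{ -\infty,+\infty\}$ with $S$ a set of even integers, and let $\mathbf{even}\in\mathsf{EVEN}$ consist of all even integers together with $\pm\infty$. Ordered by the expressiveness relation $\preccurlyeq$, the collection $\{\mathrm{MTL}^{\mathcal{I}}\mid\mathcal{I}\in\mathsf{EVEN}\}$ forms a complete lattice in which (i) the greatest element is $\mathrm{MTL}^{\mathbf{even}}$, (ii) the least element is $\mathrm{MTL}^{\{ -\infty,+\infty\}}$, and for every nonempty $S\subseteq\mathsf{EVEN}$, (iii) the meet of $\{\mathrm{MTL}^{\mathcal{I}}\mid\mathcal{I}\in S\}$ is $\mathrm{MTL}^{\bigcap_{\mathcal{I}\in S}\mathcal{I}}$ and (iv) its join is $\mathrm{MTL}^{\bigcup_{\mathcal{I}\in S}\mathcal{I}}$.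
   Context: Data words: infinite sequences $(P_0,d_0)(P_1,d_1)\dots$ with $P_i\subseteq\mathcal{P}$ (finite set of propositions) and $d_i\in\mathbb{N}$. MTL formulas: $\varphi::=p\mid\neg\varphi\mid\varphi_1\wedge\varphi_2\mid\varphi_1\mathsf{U}_I\varphi_2$, $I$ an integer interval with endpoints in $\mathbb{Z}\cup\{\pm\infty\}$; $(w,i)\models p$ iff $p\in P_i$; $(w,i)\models\varphi_1\mathsf{U}_I\varphi_2$ iff there is $j>i$ with $(w,j)\models\varphi_2$, $d_j-d_i\in I$, and $(w,k)\models\varphi_1$ for all $i<k<j$; $w\models\varphi$ iff $(w,0)\models\varphi$. For $\mathcal{I}=S\cup\{\pm\infty\}$, $S\subseteq\mathbb{Z}$, $\mathrm{MTL}^{\mathcal{I}}$ is the set of MTL formulas all of whose interval endpoints lie in $\mathcal{I}$. $\mathcal{L}\preccurlyeq\mathcal{L}'$ means every formula of $\mathcal{L}$ is satisfied by exactly the same data words as some formula of $\mathcal{L}'$; logics are compared up to this equivalence. -}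

module Defs where

open import Level using (Level; _⊔_; Lift; 0ℓ) renaming (suc to lsuc)
open import Data.Nat using (ℕ) renaming (_<_ to _<ℕ_)
open import Data.Integer using (ℤ; +_; _-_; _≤_; _<_)
open import Data.Integer.Divisibility using (_∣_)
open import Data.Fin using (Fin)
open import Data.Fin.Subset using (Subset; _∈_)
open import Data.Product using (Σ; _×_; ∃)
open import Data.Unit using (⊤)
open import Data.Empty using (⊥)
open import Relation.Nullary using (¬_)
open import Relation.Unary using (Pred)
open import Function.Bundles using (_⇔_)

DataWord : ℕ → Set
DataWord n = ℕ → Subset n × ℕ

data LowerBound : Set where
  -∞   : LowerBound
  incl : ℤ → LowerBound
  excl : ℤ → LowerBound

data UpperBound : Set where
  +∞   : UpperBound
  incl : ℤ → UpperBound
  excl : ℤ → UpperBound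

record Interval : Set where
  constructor ⟨_,_⟩
  field
    lower : LowerBound
    upper : UpperBound

_∈L_ : ℤ → LowerBound → Set
z ∈L -∞     = ⊤
z ∈L incl a = a ≤ z
z ∈L excl a = a < z

_∈U_ : ℤ → UpperBound → Set
z ∈U +∞     = ⊤
z ∈U incl b = z ≤ b
z ∈U excl b = z < b

_∈I_ : ℤ → Interval → Set
z ∈I ⟨ l , u ⟩ = (z ∈L l) × (z ∈U u)

data Formula (n : ℕ) : Set where
  prop : Fin n → Formula n
  ¬'   : Formula n → Formula n
  _∧'_ : Formula n → Formula n → Formula n
  U    : Interval → Formula n → Formula n → Formula n

Sat : ∀ {n} → DataWord n → ℕ → Formula n → Set
Sat w i (prop p) = p ∈ Data.Product.proj₁ (w i)
Sat w i (¬' φ) = ¬ Sat w i φ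
Sat w i (φ ∧' ψ) = Sat w i φ × Sat w i ψ
Sat w i (U I φ ψ) =
  Σ ℕ λ j → (i <ℕ j) × Sat w j ψ
          × ((+ Data.Product.proj₂ (w j) - + Data.Product.proj₂ (w i)) ∈I I)
          × (∀ k → i <ℕ k → k <ℕ j → Sat w k φ)

_⊨_ : ∀ {n} → DataWord n → Formula n → Set
w ⊨ φ = Sat w 0 φ

-- A set 𝓘 = S ∪ {-∞,+∞} of endpoints is represented by its integer part
-- S : Pred ℤ ℓ (±∞ are always allowed).
LowerIn : ∀ {ℓ} → Pred ℤ ℓ → LowerBound → Set ℓ
LowerIn S -∞       = Lift _ ⊤
LowerIn S (incl a) = S a
LowerIn S (excl a) = S a

UpperIn : ∀ {ℓ} → Pred ℤ ℓ → UpperBound → Set ℓ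
UpperIn S +∞       = Lift _ ⊤
UpperIn S (incl b) = S b
UpperIn S (excl b) = S b

InMTL : ∀ {ℓ n} → Pred ℤ ℓ → Formula n → Set ℓ
InMTL S (prop p) = Lift _ ⊤
InMTL S (¬' φ) = InMTL S φ
InMTL S (φ ∧' ψ) = InMTL S φ × InMTL S ψ
InMTL S (U ⟨ l , u ⟩ φ ψ) = LowerIn S l × UpperIn S u × InMTL S φ × InMTL S ψ

Expr≼ : ∀ {ℓ ℓ'} (n : ℕ) → Pred ℤ ℓ → Pred ℤ ℓ' → Set (ℓ ⊔ ℓ')
Expr≼ n S T = ∀ (φ : Formula n) → InMTL S φ →
  Σ (Formula n) λ ψ → InMTL T ψ × (∀ (w : DataWord n) → (w ⊨ φ) ⇔ (w ⊨ ψ))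

Even : ℤ → Set
Even z = + 2 ∣ z

IsEVEN : ∀ {ℓ} → Pred ℤ ℓ → Set ℓ
IsEVEN S = ∀ z → S z → Even z

evenSet : Pred ℤ 0ℓ
evenSet = Even

infSet : Pred ℤ 0ℓ
infSet _ = ⊥

Family : Set₁
Family = Pred (Pred ℤ 0ℓ) 0ℓ

⋂ : Family → Pred ℤ (lsuc 0ℓ)
⋂ 𝒮 z = ∀ (I : Pred ℤ 0ℓ) → 𝒮 I → I z

⋃ : Family → Pred ℤ (lsuc 0ℓ)
⋃ 𝒮 z = Σ (Pred ℤ 0ℓ) λ I → 𝒮 I × I z

IsMeet : ∀ {ℓ} → ℕ → Family → Pred ℤ ℓ → Set (lsuc 0ℓ ⊔ ℓ)
IsMeet n 𝒮 M =
  IsEVEN M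
  × (∀ I → 𝒮 I → Expr≼ n M I)
  × (∀ (J : Pred ℤ 0ℓ) → IsEVEN J → (∀ I → 𝒮 I → Expr≼ n J I) → Expr≼ n J M)

IsJoin : ∀ {ℓ} → ℕ → Family → Pred ℤ ℓ → Set (lsuc 0ℓ ⊔ ℓ)
IsJoin n 𝒮 M =
  IsEVEN M
  × (∀ I → 𝒮 I → Expr≼ n I M)
  × (∀ (J : Pred ℤ 0ℓ) → IsEVEN J → (∀ I → 𝒮 I → Expr≼ n I J) → Expr≼ n M J)

{-# OPTIONS --safe #-}
-- For sets of even endpoints and at least one proposition, MTL^S ≼ MTL^T holds
-- exactly when S ⊆ T, so the lattice in question is the powerset lattice of the
-- even integers. Inclusion gives expressiveness syntactically. Conversely, let c
-- be an even endpoint in S but not in T, and m − m₀ = c. The words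
-- (∅,m₀)(∅,m)(∅,m)… and (∅,m₀+1)(∅,m)(∅,m)… agree from position 1 on, and seen
-- from position 0 every later position is c, respectively c − 1, away. An
-- interval whose endpoints are even and different from c contains both c and
-- c − 1 or neither, so no MTL^T formula separates the two words, whereas the
-- MTL^S formula ⊤ U_[c,c] ⊤ does. Without propositions there are no formulas.
module Submission where

open import Defs
open import Level using (Level; 0ℓ; lift)
open import Data.Nat as ℕ using (ℕ; zero; suc; s≤s; z≤n)
import Data.Nat.Properties as ℕ
import Data.Nat.Divisibility as ℕ
open import Data.Integer using (ℤ; +_; -[1+_]; _-_; _≤_; _<_; pred) renaming (suc to sucℤ)
open import Data.Integer.Properties
  using ( _≟_; ≤-refl; ≤-trans; <-≤-trans; ≤-<-trans; <⇒≱; ≤∧≢⇒<; +-identityʳ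
        ; suc-pred; minus-suc; i≤j⇒pred[i]≤j; i<j⇒i≤pred[j]; i≤pred[j]⇒i<j; i<j⇒suc[i]≤j)
open import Data.Integer.Divisibility.Signed using (∣ᵤ⇒∣; ∣⇒∣ᵤ; ∣m+n∣n⇒∣m)
open import Data.Fin.Patterns using (0F)
open import Data.Fin.Subset using (_∈_) renaming (⊥ to ∅)
open import Data.Product using (Σ; ∃₂; _×_; _,_; proj₁; proj₂)
open import Data.Product.Function.NonDependent.Propositional using (_×-⇔_)
open import Data.Sum using (_⊎_; inj₁; inj₂; map₂)
open import Data.Empty using (⊥-elim)
open import Data.Unit using (tt)
open import Function using (id; _∘_)
open import Function.Bundles using (_⇔_; mk⇔; Equivalence)
open import Function.Construct.Identity using (⇔-id)
open import Function.Related.TypeIsomorphisms using (¬-cong-⇔)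
open import Relation.Nullary using (¬_; yes; no)
open import Relation.Unary using (Pred; _⊆_)
open import Relation.Binary.PropositionalEquality using (_≡_; _≢_; refl; sym; subst; subst₂; ≢-sym)

open Equivalence using (to; from)

private
  variable
    ℓ ℓ′ : Level
    n : ℕ
    S : Pred ℤ ℓ
    T : Pred ℤ ℓ′

LowerIn-mono : S ⊆ T → ∀ l → LowerIn S l → LowerIn T l
LowerIn-mono S⊆T -∞       _  = lift tt
LowerIn-mono S⊆T (incl a) Sa = S⊆T Sa
LowerIn-mono S⊆T (excl a) Sa = S⊆T Sa

UpperIn-mono : S ⊆ T → ∀ u → UpperIn S u → UpperIn T u
UpperIn-mono S⊆T +∞       _  = lift tt
UpperIn-mono S⊆T (incl b) Sb = S⊆T Sb
UpperIn-mono S⊆T (excl b) Sb = S⊆T Sb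

InMTL-mono : S ⊆ T → (φ : Formula n) → InMTL S φ → InMTL T φ
InMTL-mono S⊆T (prop p)  _         = lift tt
InMTL-mono S⊆T (¬' φ)    Sφ        = InMTL-mono S⊆T φ Sφ
InMTL-mono S⊆T (φ ∧' ψ)  (Sφ , Sψ) = InMTL-mono S⊆T φ Sφ , InMTL-mono S⊆T ψ Sψ
InMTL-mono S⊆T (U ⟨ l , u ⟩ φ ψ) (Sl , Su , Sφ , Sψ) =
  LowerIn-mono S⊆T l Sl , UpperIn-mono S⊆T u Su , InMTL-mono S⊆T φ Sφ , InMTL-mono S⊆T ψ Sψ

⊆⇒≼ : S ⊆ T → Expr≼ n S T
⊆⇒≼ S⊆T φ Sφ = φ , InMTL-mono S⊆T φ Sφ , λ _ → ⇔-id _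

¬Formula-0 : ¬ Formula 0
¬Formula-0 (prop ())
¬Formula-0 (¬' φ)    = ¬Formula-0 φ
¬Formula-0 (φ ∧' _)  = ¬Formula-0 φ
¬Formula-0 (U _ φ _) = ¬Formula-0 φ

Expr≼-0 : Expr≼ 0 S T
Expr≼-0 φ _ = ⊥-elim (¬Formula-0 φ)

delay : DataWord n → ℕ → ℕ → ℤ
delay w i j = + proj₂ (w j) - + proj₂ (w i)

Sat-suffix : (w w′ : DataWord n) (i : ℕ) (φ : Formula n) →
             (∀ {j} → i ℕ.≤ j → w j ≡ w′ j) → Sat w i φ → Sat w′ i φ
Sat-suffix w w′ i (prop p) w≡w′ wφ = subst (λ x → p ∈ proj₁ x) (w≡w′ ℕ.≤-refl) wφ
Sat-suffix w w′ i (¬' φ) w≡w′ ¬wφ w′φ = ¬wφ (Sat-suffix w′ w i φ (λ i≤j → sym (w≡w′ i≤j)) w′φ)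
Sat-suffix w w′ i (φ ∧' ψ) w≡w′ (wφ , wψ) = Sat-suffix w w′ i φ w≡w′ wφ , Sat-suffix w w′ i ψ w≡w′ wψ
Sat-suffix w w′ i (U I φ ψ) w≡w′ (j , i<j , wψ , δ∈I , wφ) =
    j , i<j , Sat-suffix w w′ j ψ (from-later i<j) wψ
  , subst₂ (λ x y → (+ proj₂ x - + proj₂ y) ∈I I) (w≡w′ (ℕ.<⇒≤ i<j)) (w≡w′ ℕ.≤-refl) δ∈I
  , λ k i<k k<j → Sat-suffix w w′ k φ (from-later i<k) (wφ k i<k k<j)
  where
  from-later : ∀ {k} → i ℕ.< k → ∀ {j} → k ℕ.≤ j → w j ≡ w′ j
  from-later i<k k≤j = w≡w′ (ℕ.≤-trans (ℕ.<⇒≤ i<k) k≤j)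

U-at-0-transfer : (w w′ : DataWord n) (I : Interval) (φ ψ : Formula n) →
  (∀ {j} → 1 ℕ.≤ j → w j ≡ w′ j) → (∀ j → delay w 0 (suc j) ∈I I → delay w′ 0 (suc j) ∈I I) →
  Sat w 0 (U I φ ψ) → Sat w′ 0 (U I φ ψ)
U-at-0-transfer w w′ I φ ψ w≡w′ δ-transfer (suc j , 0<j , wψ , δ∈I , wφ) =
    suc j , 0<j , Sat-suffix w w′ (suc j) ψ (from-later 0<j) wψ
  , δ-transfer j δ∈I
  , λ k 0<k k<j → Sat-suffix w w′ k φ (from-later 0<k) (wφ k 0<k k<j)
  where
  from-later : ∀ {k} → 0 ℕ.< k → ∀ {j} → k ℕ.≤ j → w j ≡ w′ j
  from-later 0<k k≤j = w≡w′ (ℕ.≤-trans 0<k k≤j)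

Even⇒¬Even-suc : ∀ {a} → Even a → ¬ Even (sucℤ a)
Even⇒¬Even-suc {a} 2∣a 2∣1+a
  with ℕ.∣1⇒≡1 (∣⇒∣ᵤ (∣m+n∣n⇒∣m {+ 2} {+ 1} {a} (∣ᵤ⇒∣ {+ 2} {sucℤ a} 2∣1+a) (∣ᵤ⇒∣ {+ 2} {a} 2∣a)))
... | ()

Even⇒≢pred-Even : ∀ {a c} → Even a → Even c → a ≢ pred c
Even⇒≢pred-Even {c = c} 2∣a 2∣c refl = Even⇒¬Even-suc {pred c} 2∣a (subst Even (sym (suc-pred c)) 2∣c)

pred≤ : ∀ c → pred c ≤ c
pred≤ c = i≤j⇒pred[i]≤j ≤-refl

pred<⇒≤ : ∀ {c b} → pred c < b → c ≤ b
pred<⇒≤ {c} c-1<b = subst (_≤ _) (suc-pred c) (i<j⇒suc[i]≤j c-1<b)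

zip-⊎ : ∀ {x a b c} {X : Set x} {A : Set a} {B : Set b} {C : Set c} →
        (A → B → C) → X ⊎ A → X ⊎ B → X ⊎ C
zip-⊎ f (inj₁ x) _        = inj₁ x
zip-⊎ f (inj₂ a) (inj₁ x) = inj₁ x
zip-⊎ f (inj₂ a) (inj₂ b) = inj₂ (f a b)

-- Besides [c and c), only the endpoints (c − 1 and c − 1] separate c from c − 1, and parity rules them out.
module _ {T : Pred ℤ ℓ} (T-even : IsEVEN T) {c : ℤ} (c-even : Even c) where

  private
    ≢pred : ∀ {a} → T a → a ≢ pred c
    ≢pred Ta = Even⇒≢pred-Even {c = c} (T-even _ Ta) c-even

  ∈L-pred : ∀ l → LowerIn T l → T c ⊎ (c ∈L l ⇔ pred c ∈L l)
  ∈L-pred -∞       _  = inj₂ (⇔-id _)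
  ∈L-pred (incl a) Ta with a ≟ c
  ... | yes refl = inj₁ Ta
  ... | no a≢c   = inj₂ (mk⇔ (λ a≤c → i<j⇒i≤pred[j] (≤∧≢⇒< a≤c a≢c)) (λ a≤c-1 → ≤-trans a≤c-1 (pred≤ c)))
  ∈L-pred (excl a) Ta =
    inj₂ (mk⇔ (λ a<c → ≤∧≢⇒< (i<j⇒i≤pred[j] a<c) (≢pred Ta)) (λ a<c-1 → <-≤-trans a<c-1 (pred≤ c)))

  ∈U-pred : ∀ u → UpperIn T u → T c ⊎ (c ∈U u ⇔ pred c ∈U u)
  ∈U-pred +∞       _  = inj₂ (⇔-id _)
  ∈U-pred (incl b) Tb =
    inj₂ (mk⇔ (≤-trans (pred≤ c)) (λ c-1≤b → pred<⇒≤ (≤∧≢⇒< c-1≤b (≢-sym (≢pred Tb)))))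
  ∈U-pred (excl b) Tb with b ≟ c
  ... | yes refl = inj₁ Tb
  ... | no b≢c   = inj₂ (mk⇔ (≤-<-trans (pred≤ c)) (λ c-1<b → ≤∧≢⇒< (pred<⇒≤ c-1<b) (≢-sym b≢c)))

  ∈I-pred : ∀ l u → LowerIn T l → UpperIn T u → T c ⊎ (c ∈I ⟨ l , u ⟩ ⇔ pred c ∈I ⟨ l , u ⟩)
  ∈I-pred l u Tl Tu = zip-⊎ _×-⇔_ (∈L-pred l Tl) (∈U-pred u Tu)

⊤′ : Formula (suc n)
⊤′ = ¬' (prop 0F ∧' ¬' (prop 0F))

⊤′-holds : (w : DataWord (suc n)) (i : ℕ) → Sat w i ⊤′
⊤′-holds w i (p , ¬p) = ¬p p

eventually-at : ℤ → Formula (suc n)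
eventually-at c = U ⟨ incl c , incl c ⟩ ⊤′ ⊤′

eventually-at-InMTL : (S : Pred ℤ ℓ) {c : ℤ} → S c → InMTL {n = suc n} S (eventually-at c)
eventually-at-InMTL S Sc = Sc , Sc , (lift tt , lift tt) , (lift tt , lift tt)

twoPoint : ℕ → ℕ → DataWord n
twoPoint d₀ d zero    = ∅ , d₀
twoPoint d₀ d (suc _) = ∅ , d

module TwoPoint (m₀ m : ℕ) where

  A B : DataWord n
  A = twoPoint m₀ m
  B = twoPoint (suc m₀) m

  δ : ℤ
  δ = + m - + m₀

  private
    A≡B : ∀ {j} → 1 ℕ.≤ j → A {n} j ≡ B j
    A≡B {j = suc _} _ = refl

    delay-B : + m - + suc m₀ ≡ pred δ
    delay-B = minus-suc (+ m) m₀

  indistinguishable : {T : Pred ℤ ℓ} → IsEVEN T → Even δ →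
                      (ψ : Formula n) → InMTL T ψ → T δ ⊎ (Sat A 0 ψ ⇔ Sat B 0 ψ)
  indistinguishable T-even δ-even (prop p) _ = inj₂ (⇔-id _)
  indistinguishable T-even δ-even (¬' ψ) Tψ = map₂ ¬-cong-⇔ (indistinguishable T-even δ-even ψ Tψ)
  indistinguishable T-even δ-even (φ ∧' ψ) (Tφ , Tψ) =
    zip-⊎ _×-⇔_ (indistinguishable T-even δ-even φ Tφ) (indistinguishable T-even δ-even ψ Tψ)
  indistinguishable T-even δ-even (U I@(⟨ l , u ⟩) φ ψ) (Tl , Tu , _) =
    map₂ U-iff (∈I-pred T-even δ-even l u Tl Tu)
    where
    U-iff : δ ∈I I ⇔ pred δ ∈I I → Sat A 0 (U I φ ψ) ⇔ Sat B 0 (U I φ ψ)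
    U-iff δ⇔δ-1 = mk⇔
      (U-at-0-transfer A B I φ ψ A≡B λ _ → subst (_∈I I) (sym delay-B) ∘ to δ⇔δ-1)
      (U-at-0-transfer B A I φ ψ (sym ∘ A≡B) λ _ → from δ⇔δ-1 ∘ subst (_∈I I) delay-B)

  A-eventually-at-δ : Sat (A {suc n}) 0 (eventually-at δ)
  A-eventually-at-δ = 1 , s≤s z≤n , ⊤′-holds A 1 , (≤-refl , ≤-refl) , λ k _ _ → ⊤′-holds A k

  ¬B-eventually-at-δ : ¬ Sat (B {suc n}) 0 (eventually-at δ)
  ¬B-eventually-at-δ (suc _ , _ , _ , (δ≤δ-1 , _) , _) =
    <⇒≱ (i≤pred[j]⇒i<j ≤-refl) (subst (δ ≤_) delay-B δ≤δ-1)

difference-of-naturals : ∀ c → ∃₂ λ m₀ m → + m - + m₀ ≡ c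
difference-of-naturals (+ k)    = 0 , k , +-identityʳ (+ k)
difference-of-naturals -[1+ k ] = suc k , 0 , refl

≼⇒⊆ : IsEVEN S → IsEVEN T → Expr≼ (suc n) S T → S ⊆ T
≼⇒⊆ {S = S} {n = n} S-even T-even S≼T {c} Sc with difference-of-naturals c
... | m₀ , m , refl with S≼T (eventually-at c) (eventually-at-InMTL {n = n} S Sc)
... | ψ , Tψ , φ⇔ψ with TwoPoint.indistinguishable m₀ m T-even (S-even c Sc) ψ Tψ
... | inj₁ Tc  = Tc
... | inj₂ A⇔B = ⊥-elim (¬B-eventually-at-δ (from (φ⇔ψ B) (to A⇔B (to (φ⇔ψ A) A-eventually-at-δ))))
  where open TwoPoint m₀ m

⋂-greatest : ∀ {𝒮 : Family} {J : Pred ℤ 0ℓ} → (∀ I → 𝒮 I → IsEVEN I) → IsEVEN J →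
             (∀ I → 𝒮 I → Expr≼ n J I) → Expr≼ n J (⋂ 𝒮)
⋂-greatest {n = zero}  _      _      _  = Expr≼-0
⋂-greatest {n = suc _} 𝒮-even J-even J≼ =
  ⊆⇒≼ λ Jz I I∈𝒮 → ≼⇒⊆ J-even (𝒮-even I I∈𝒮) (J≼ I I∈𝒮) Jz

⋃-least : ∀ {𝒮 : Family} {J : Pred ℤ 0ℓ} → (∀ I → 𝒮 I → IsEVEN I) → IsEVEN J →
          (∀ I → 𝒮 I → Expr≼ n I J) → Expr≼ n (⋃ 𝒮) J
⋃-least {n = zero}  _      _      _  = Expr≼-0
⋃-least {n = suc _} 𝒮-even J-even ≼J =
  ⊆⇒≼ λ { (I , I∈𝒮 , Iz) → ≼⇒⊆ (𝒮-even I I∈𝒮) J-even (≼J I I∈𝒮) Iz }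

⋂-isMeet : ∀ n (𝒮 : Family) → (∀ I → 𝒮 I → IsEVEN I) → Σ (Pred ℤ 0ℓ) 𝒮 → IsMeet n 𝒮 (⋂ 𝒮)
⋂-isMeet n 𝒮 𝒮-even (I₀ , I₀∈𝒮) =
    (λ z ⋂z → 𝒮-even I₀ I₀∈𝒮 z (⋂z I₀ I₀∈𝒮))
  , (λ I I∈𝒮 → ⊆⇒≼ λ ⋂z → ⋂z I I∈𝒮)
  , (λ J J-even → ⋂-greatest 𝒮-even J-even)

⋃-isJoin : ∀ n (𝒮 : Family) → (∀ I → 𝒮 I → IsEVEN I) → Σ (Pred ℤ 0ℓ) 𝒮 → IsJoin n 𝒮 (⋃ 𝒮)
⋃-isJoin n 𝒮 𝒮-even _ =
    (λ { z (I , I∈𝒮 , Iz) → 𝒮-even I I∈𝒮 z Iz })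
  , (λ I I∈𝒮 → ⊆⇒≼ λ Iz → I , I∈𝒮 , Iz)
  , (λ J J-even → ⋃-least 𝒮-even J-even)

proposition3 : (n : ℕ) →
    -- (i) greatest element MTL^even
    (IsEVEN evenSet × (∀ (I : Pred ℤ 0ℓ) → IsEVEN I → Expr≼ n I evenSet))
    -- (ii) least element MTL over only ±∞
    × (IsEVEN infSet × (∀ (I : Pred ℤ 0ℓ) → IsEVEN I → Expr≼ n infSet I))
    -- (iii) meets of nonempty families
    × (∀ (𝒮 : Family) → (∀ I → 𝒮 I → IsEVEN I) → Σ (Pred ℤ 0ℓ) 𝒮 → IsMeet n 𝒮 (⋂ 𝒮))
    -- (iv) joins of nonempty families
    × (∀ (𝒮 : Family) → (∀ I → 𝒮 I → IsEVEN I) → Σ (Pred ℤ 0ℓ) 𝒮 → IsJoin n 𝒮 (⋃ 𝒮))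
proposition3 n =
    ((λ _ → id) , λ I I-even → ⊆⇒≼ (I-even _))
  , ((λ _ ()) , λ _ _ → ⊆⇒≼ λ ())
  , ⋂-isMeet n
  , ⋃-isJoin n
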